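{- Every quiddity cycle contains at least one of $(0,0)$, $(1,1)$, $(1,2)$, or $(1,3)$.
   Context: A finite sequence is an element of $\mathbb{N}_0^n$ for some $n\ge1$. $(\!(c_1,\dots,c_n)\!)$ denotes the orbit of $(c_1,\dots,c_n)$ under the dihedral group acting on positions (rotations and reversal); its elements are representatives. Quiddity cycles form the smallest set $\mathcal{A}$ of such orbits containing $(\!(0,0)\!)$ and such that $(\!(c_1,\dots,c_n)\!)\in\mathcal{A}$ (any representative) implies $(\!(c_1+1,1,c_2+1,c_3,\dots,c_n)\!)\in\mathcal{A}$. A sequence $(d_1,\dots,d_m)$ is contained in $c$ if there are a representative $(c_1,\dots,c_n)$ of $c$ and $k\ge0$ with $c_{k+i}=d_i$ for $i=1,\dots,m$, indices read cyclically modulo $n$. -}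

module Defs where

open import Data.Nat using (ℕ; zero; suc; _+_; _%_; NonZero)
open import Data.List using (List; []; _∷_; _++_; reverse; length; lookup)
open import Data.Fin using (Fin; fromℕ<)
open import Data.Nat.DivMod using (m%n<n)
open import Data.Product using (∃; ∃-syntax; _×_; _,_)
open import Relation.Binary.PropositionalEquality using (_≡_)

-- Finite sequences are lists of naturals; orbits under the dihedral group
-- are represented by any of their representatives, and the relation
-- "is a representative of the same orbit" is generated below.

rotate : List ℕ → List ℕ
rotate []       = []
rotate (x ∷ xs) = xs ++ (x ∷ [])

-- Dihedral equivalence: reflexive-transitive closure of rotation and
-- reversal (both generate the dihedral group acting on positions; the
-- closure is symmetric since rotation and reversal have finite order).
data _∼_ : List ℕ → List ℕ → Set where
  ∼-refl  : ∀ {c} → c ∼ c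
  ∼-rot   : ∀ {c d} → c ∼ d → c ∼ rotate d
  ∼-rev   : ∀ {c d} → c ∼ d → c ∼ reverse d

data Quiddity : List ℕ → Set where
  base  : Quiddity (0 ∷ 0 ∷ [])
  step  : ∀ {c₁ c₂ cs} → Quiddity (c₁ ∷ c₂ ∷ cs) →
          Quiddity (suc c₁ ∷ 1 ∷ suc c₂ ∷ cs)
  orbit : ∀ {c d} → Quiddity c → c ∼ d → Quiddity d

cyc : (c : List ℕ) → .{{NonZero (length c)}} → ℕ → ℕ
cyc c i = lookup c (fromℕ< (m%n<n i (length c)))

-- (d₁,…,dₘ) is contained in the cycle of c: some representative c' of the
-- orbit of c and k ≥ 0 with c'_{k+i} = d_i (indices cyclic, 1-based in the
-- paper; here 0-based: c'[(k+i) mod n] = d[i]).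
Contains : List ℕ → List ℕ → Set
Contains c d = ∃[ c' ] ∃[ nz ] (c ∼ c') × ∃[ k ]
  (∀ (i : Fin (length d)) →
     cyc c' {{nz}} (k + Data.Fin.toℕ i) ≡ lookup d i)

-- A binary tree with n nodes is the dual tree of a triangulated (n+2)-gon rooted at an
-- edge, and its quiddity lists, for each polygon vertex, the number of triangles at that
-- vertex.  Every quiddity cycle arises in this way, because the tree quiddities are
-- closed under rotation (moving the root edge), reversal (mirroring the tree) and the
-- defining step (attaching an ear).  A tree either has at most one node, giving (0,0) or
-- (1,1,1), or it contains a node whose subtrees have at most one node each; the vertices
-- around such a node carry one of the adjacent pairs (1,1), (1,2), (1,3) or a reversal.
module Submission where

open import Defs
open import Data.Nat using (ℕ; suc; _+_)
open import Data.Nat.Properties using (+-suc; +-identityʳ; +-comm)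
open import Data.List using (List; []; _∷_; _++_; reverse; _∷ʳ_)
open import Data.List.Properties
  using (++-assoc; ++-identityʳ; reverse-++; unfold-reverse; ∷-injective; ∷ʳ-injective)
import Data.Fin as Fin
open import Data.Product using (∃-syntax; _×_; _,_)
open import Data.Sum using (_⊎_; inj₁; inj₂)
open import Relation.Binary.PropositionalEquality
  using (_≡_; refl; sym; cong; cong₂; subst; module ≡-Reasoning)

∼-++-swap : ∀ {c} u v → c ∼ (u ++ v) → c ∼ (v ++ u)
∼-++-swap {c} []      v c∼v = subst (c ∼_) (sym (++-identityʳ v)) c∼v
∼-++-swap {c} (a ∷ u) v c∼a∷u++v =
  subst (c ∼_) (++-assoc v (a ∷ []) u)
    (∼-++-swap u (v ++ a ∷ [])
      (subst (c ∼_) (++-assoc u v (a ∷ [])) (∼-rot c∼a∷u++v)))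

-- With the pair at the front, the cyclic lookups at 0 and 1 compute definitionally.
∼-front⇒Contains : ∀ {c x y w} → c ∼ (x ∷ y ∷ w) → Contains c (x ∷ y ∷ [])
∼-front⇒Contains c∼xyw = _ , _ , c∼xyw , 0 , λ { Fin.zero → refl ; (Fin.suc Fin.zero) → refl }

Adjacent : List ℕ → ℕ → ℕ → Set
Adjacent c x y = ∃[ u ] ∃[ w ] c ≡ u ++ x ∷ y ∷ w

Adjacent-∷ : ∀ {c x y} k → Adjacent c x y → Adjacent (k ∷ c) x y
Adjacent-∷ k (u , w , refl) = k ∷ u , w , refl

Adjacent-++ˡ : ∀ {c x y} d → Adjacent c x y → Adjacent (c ++ d) x y
Adjacent-++ˡ {x = x} {y} d (u , w , refl) = u , w ++ d , ++-assoc u (x ∷ y ∷ w) d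

Adjacent-++ʳ : ∀ {c x y} d → Adjacent c x y → Adjacent (d ++ c) x y
Adjacent-++ʳ {x = x} {y} d (u , w , refl) = d ++ u , w , sym (++-assoc d u (x ∷ y ∷ w))

reverse-Adjacent : ∀ {c x y} → Adjacent c x y → Adjacent (reverse c) y x
reverse-Adjacent {x = x} {y} (u , w , refl) = reverse w , reverse u , (begin
  reverse (u ++ x ∷ y ∷ w)               ≡⟨ reverse-++ u (x ∷ y ∷ w) ⟩
  reverse (x ∷ y ∷ w) ++ reverse u       ≡⟨ cong (_++ reverse u) (reverse-++ (x ∷ y ∷ []) w) ⟩
  (reverse w ++ y ∷ x ∷ []) ++ reverse u ≡⟨ ++-assoc (reverse w) (y ∷ x ∷ []) (reverse u) ⟩
  reverse w ++ y ∷ x ∷ reverse u         ∎)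
  where open ≡-Reasoning

Adjacent⇒Contains : ∀ {c x y} → Adjacent c x y → Contains c (x ∷ y ∷ [])
Adjacent⇒Contains {x = x} {y} (u , w , refl) =
  ∼-front⇒Contains (∼-++-swap u (x ∷ y ∷ w) ∼-refl)

Adjacent⇒Contains-reversed : ∀ {c x y} → Adjacent c x y → Contains c (y ∷ x ∷ [])
Adjacent⇒Contains-reversed {c} adj with reverse-Adjacent adj
... | u , w , eq = ∼-front⇒Contains (∼-++-swap u _ (subst (c ∼_) eq (∼-rev ∼-refl)))

data Tree : Set where
  leaf : Tree
  node : Tree → Tree → Tree

leftSpine rightSpine : Tree → ℕ
leftSpine leaf       = 0
leftSpine (node l r) = suc (leftSpine l)
rightSpine leaf       = 0
rightSpine (node l r) = suc (rightSpine r)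

-- The vertex between the polygons of l and r lies in the triangle of the node itself,
-- in the triangles of the right spine of l and in those of the left spine of r.
inner : Tree → List ℕ
inner leaf       = []
inner (node l r) = inner l ++ suc (rightSpine l + leftSpine r) ∷ inner r

quiddity : Tree → List ℕ
quiddity t = leftSpine t ∷ inner t ++ rightSpine t ∷ []

Triangulated : List ℕ → Set
Triangulated c = ∃[ t ] quiddity t ≡ c

-- reroot t s glues the polygons of t and s along their root edges and roots the result
-- at the edge following the root edge of t.
reroot : Tree → Tree → Tree
reroot leaf       s = s
reroot (node l r) s = reroot l (node r s)

quiddity-reroot : ∀ t s → quiddity (reroot t s) ≡
  inner t ++ (rightSpine t + leftSpine s) ∷ inner s ++ (rightSpine s + leftSpine t) ∷ []
quiddity-reroot leaf s = cong (λ k → leftSpine s ∷ inner s ++ k ∷ []) (sym (+-identityʳ (rightSpine s)))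
quiddity-reroot (node l r) s = begin
  quiddity (reroot l (node r s))
    ≡⟨ quiddity-reroot l (node r s) ⟩
  inner l ++ (Rl + suc Lr) ∷ (inner r ++ suc (Rr + Ls) ∷ inner s) ++ (suc Rs + Ll) ∷ []
    ≡⟨ cong₂ (λ a b → inner l ++ a ∷ (inner r ++ suc (Rr + Ls) ∷ inner s) ++ b ∷ [])
             (+-suc Rl Lr) (sym (+-suc Rs Ll)) ⟩
  inner l ++ suc (Rl + Lr) ∷ (inner r ++ suc (Rr + Ls) ∷ inner s) ++ (Rs + suc Ll) ∷ []
    ≡⟨ cong (λ z → inner l ++ suc (Rl + Lr) ∷ z)
            (++-assoc (inner r) (suc (Rr + Ls) ∷ inner s) ((Rs + suc Ll) ∷ [])) ⟩
  inner l ++ suc (Rl + Lr) ∷ inner r ++ suc (Rr + Ls) ∷ inner s ++ (Rs + suc Ll) ∷ []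
    ≡⟨ sym (++-assoc (inner l) (suc (Rl + Lr) ∷ inner r) _) ⟩
  inner (node l r) ++ suc (Rr + Ls) ∷ inner s ++ (Rs + suc Ll) ∷ [] ∎
  where
  open ≡-Reasoning
  Ll = leftSpine l
  Rl = rightSpine l
  Lr = leftSpine r
  Rr = rightSpine r
  Ls = leftSpine s
  Rs = rightSpine s

quiddity-rotate : ∀ t → quiddity (reroot t leaf) ≡ rotate (quiddity t)
quiddity-rotate t = begin
  quiddity (reroot t leaf)                             ≡⟨ quiddity-reroot t leaf ⟩
  inner t ++ (rightSpine t + 0) ∷ leftSpine t ∷ []     ≡⟨ cong (λ k → inner t ++ k ∷ leftSpine t ∷ [])
                                                               (+-identityʳ (rightSpine t)) ⟩
  inner t ++ rightSpine t ∷ leftSpine t ∷ []           ≡⟨ sym (++-assoc (inner t) (rightSpine t ∷ []) _) ⟩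
  rotate (quiddity t)                                  ∎
  where open ≡-Reasoning

mirror : Tree → Tree
mirror leaf       = leaf
mirror (node l r) = node (mirror r) (mirror l)

leftSpine-mirror : ∀ t → leftSpine (mirror t) ≡ rightSpine t
leftSpine-mirror leaf       = refl
leftSpine-mirror (node l r) = cong suc (leftSpine-mirror r)

rightSpine-mirror : ∀ t → rightSpine (mirror t) ≡ leftSpine t
rightSpine-mirror leaf       = refl
rightSpine-mirror (node l r) = cong suc (rightSpine-mirror l)

inner-mirror : ∀ t → inner (mirror t) ≡ reverse (inner t)
inner-mirror leaf       = refl
inner-mirror (node l r) = begin
  inner (mirror r) ++ suc (rightSpine (mirror r) + leftSpine (mirror l)) ∷ inner (mirror l)
    ≡⟨ cong₂ (λ a b → a ++ b) (inner-mirror r) (cong₂ _∷_ (cong suc middle) (inner-mirror l)) ⟩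
  reverse (inner r) ++ k ∷ reverse (inner l)
    ≡⟨ sym (++-assoc (reverse (inner r)) (k ∷ []) (reverse (inner l))) ⟩
  (reverse (inner r) ∷ʳ k) ++ reverse (inner l)
    ≡⟨ cong (_++ reverse (inner l)) (sym (unfold-reverse k (inner r))) ⟩
  reverse (k ∷ inner r) ++ reverse (inner l)
    ≡⟨ sym (reverse-++ (inner l) (k ∷ inner r)) ⟩
  reverse (inner (node l r)) ∎
  where
  open ≡-Reasoning
  k = suc (rightSpine l + leftSpine r)
  middle : rightSpine (mirror r) + leftSpine (mirror l) ≡ rightSpine l + leftSpine r
  middle = begin
    rightSpine (mirror r) + leftSpine (mirror l) ≡⟨ cong₂ _+_ (rightSpine-mirror r) (leftSpine-mirror l) ⟩
    leftSpine r + rightSpine l                   ≡⟨ +-comm (leftSpine r) (rightSpine l) ⟩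
    rightSpine l + leftSpine r                   ∎

quiddity-mirror : ∀ t → quiddity (mirror t) ≡ reverse (quiddity t)
quiddity-mirror t = begin
  leftSpine (mirror t) ∷ inner (mirror t) ++ rightSpine (mirror t) ∷ []
    ≡⟨ cong₂ _∷_ (leftSpine-mirror t)
         (cong₂ (λ m k → m ++ k ∷ []) (inner-mirror t) (rightSpine-mirror t)) ⟩
  rightSpine t ∷ reverse (inner t) ++ leftSpine t ∷ []
    ≡⟨ cong (_∷ʳ leftSpine t) (sym (reverse-++ (inner t) (rightSpine t ∷ []))) ⟩
  reverse (inner t ++ rightSpine t ∷ []) ∷ʳ leftSpine t
    ≡⟨ sym (unfold-reverse (leftSpine t) (inner t ++ rightSpine t ∷ [])) ⟩
  reverse (quiddity t) ∎
  where open ≡-Reasoning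

Triangulated-∼ : ∀ {c d} → c ∼ d → Triangulated c → Triangulated d
Triangulated-∼ ∼-refl       tri = tri
Triangulated-∼ (∼-rot c∼d) tri with Triangulated-∼ c∼d tri
... | t , refl = reroot t leaf , quiddity-rotate t
Triangulated-∼ (∼-rev c∼d) tri with Triangulated-∼ c∼d tri
... | t , refl = mirror t , quiddity-mirror t

-- Attaching an ear: node leaf t adds a triangle on the root edge of t.
Triangulated-ear : ∀ {a xs b} → Triangulated (a ∷ xs ++ b ∷ []) →
                   Triangulated (1 ∷ suc a ∷ xs ++ suc b ∷ [])
Triangulated-ear (t , eq) with ∷-injective eq
... | refl , eq′ with ∷ʳ-injective (inner t) _ eq′
...   | refl , refl = node leaf t , refl

Quiddity⇒Triangulated : ∀ {c} → Quiddity c → Triangulated c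
Quiddity⇒Triangulated base          = leaf , refl
Quiddity⇒Triangulated (step {c₁} {c₂} {cs} q) =
  Triangulated-∼ (∼-++-swap (1 ∷ suc c₂ ∷ cs) (suc c₁ ∷ []) ∼-refl)
    (Triangulated-ear (Triangulated-∼ (∼-rot ∼-refl) (Quiddity⇒Triangulated q)))
Quiddity⇒Triangulated (orbit q c∼d) = Triangulated-∼ c∼d (Quiddity⇒Triangulated q)

data Unavoidable : ℕ → ℕ → Set where
  0-0 : Unavoidable 0 0
  1-1 : Unavoidable 1 1
  1-2 : Unavoidable 1 2
  2-1 : Unavoidable 2 1
  1-3 : Unavoidable 1 3
  3-1 : Unavoidable 3 1

HasUnavoidable : List ℕ → Set
HasUnavoidable c = ∃[ x ] ∃[ y ] Unavoidable x y × Adjacent c x y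

HasUnavoidable-inner : ∀ t → t ≡ leaf ⊎ t ≡ node leaf leaf ⊎ HasUnavoidable (inner t)
HasUnavoidable-inner leaf = inj₁ refl
HasUnavoidable-inner (node l r) with HasUnavoidable-inner l | HasUnavoidable-inner r
... | inj₁ refl        | inj₁ refl        = inj₂ (inj₁ refl)
... | inj₁ refl        | inj₂ (inj₁ refl) = inj₂ (inj₂ (2 , 1 , 2-1 , [] , [] , refl))
... | inj₂ (inj₁ refl) | inj₁ refl        = inj₂ (inj₂ (1 , 2 , 1-2 , [] , [] , refl))
... | inj₂ (inj₁ refl) | inj₂ (inj₁ refl) = inj₂ (inj₂ (1 , 3 , 1-3 , [] , 1 ∷ [] , refl))
... | inj₂ (inj₂ (x , y , p , adj)) | _  = inj₂ (inj₂ (x , y , p , Adjacent-++ˡ _ adj))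
... | _ | inj₂ (inj₂ (x , y , p , adj))  =
  inj₂ (inj₂ (x , y , p , Adjacent-++ʳ (inner l) (Adjacent-∷ _ adj)))

HasUnavoidable-quiddity : ∀ t → HasUnavoidable (quiddity t)
HasUnavoidable-quiddity t with HasUnavoidable-inner t
... | inj₁ refl                     = 0 , 0 , 0-0 , [] , [] , refl
... | inj₂ (inj₁ refl)              = 1 , 1 , 1-1 , [] , 1 ∷ [] , refl
... | inj₂ (inj₂ (x , y , p , adj)) =
  x , y , p , Adjacent-∷ (leftSpine t) (Adjacent-++ˡ (rightSpine t ∷ []) adj)

Unavoidable⇒Contains : ∀ {c x y} → Unavoidable x y → Adjacent c x y →
  Contains c (0 ∷ 0 ∷ []) ⊎ Contains c (1 ∷ 1 ∷ [])
    ⊎ Contains c (1 ∷ 2 ∷ []) ⊎ Contains c (1 ∷ 3 ∷ [])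
Unavoidable⇒Contains 0-0 adj = inj₁ (Adjacent⇒Contains adj)
Unavoidable⇒Contains 1-1 adj = inj₂ (inj₁ (Adjacent⇒Contains adj))
Unavoidable⇒Contains 1-2 adj = inj₂ (inj₂ (inj₁ (Adjacent⇒Contains adj)))
Unavoidable⇒Contains 2-1 adj = inj₂ (inj₂ (inj₁ (Adjacent⇒Contains-reversed adj)))
Unavoidable⇒Contains 1-3 adj = inj₂ (inj₂ (inj₂ (Adjacent⇒Contains adj)))
Unavoidable⇒Contains 3-1 adj = inj₂ (inj₂ (inj₂ (Adjacent⇒Contains-reversed adj)))

corollary2p11 : (c : List ℕ) → Quiddity c →
    Contains c (0 ∷ 0 ∷ []) ⊎ Contains c (1 ∷ 1 ∷ [])
      ⊎ Contains c (1 ∷ 2 ∷ []) ⊎ Contains c (1 ∷ 3 ∷ [])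
corollary2p11 c q with Quiddity⇒Triangulated q
... | t , refl with HasUnavoidable-quiddity t
...   | x , y , p , adj = Unavoidable⇒Contains p adj
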